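{- Let $t,\eta\ge 1$ be integers, let $(H,r)$ be a $(t,\eta)$-tapering rooted tree, let $G$ be a graph not containing $K_{t,t}$ as a subgraph, and let $\phi$ be a $(t,\eta)$-infusion of $(H,r)$ into $G$. Then there are at most $t^{\eta^\eta}$ vertices in $G$ that are $t$-bad for $\phi$.
   Context: All graphs are finite, without loops or parallel edges; "contains $K_{t,t}$ as a subgraph" means not necessarily induced. A rooted tree $(H,r)$ is a tree with a distinguished vertex $r$; the height $h(v)$ of $v\in V(H)$ is the number of edges of the path between $v$ and $r$, and the height of $(H,r)$ is the maximum $h(v)$. $v$ is a child of $u$ if $u,v$ are adjacent and $u$ lies on the path between $v$ and $r$. $(H,r)$ is $(t,\eta)$-tapering if it has height $\eta$ and every vertex $v$ of height $i<\eta$ has exactly $t^{\eta-i}$ children. A map $\phi:V(H)\to V(G)$ is a $(t,\eta)$-infusion of $(H,r)$ into $G$ if: whenever $u,v$ are $H$-adjacent, $\phi(u),\phi(v)$ are distinct and $G$-adjacent; for each $u\in V(H)$, distinct children $v,w$ of $u$ have $\phi(v)\ne\phi(w)$; for every path $P$ of $H$ with one end $r$, the vertices $\phi(v)$ $(v\in V(P))$ are all distinct; and for every such path $P$ and distinct $u,v\in V(P)$, $\phi(u),\phi(v)$ are $G$-adjacent if and only if $u,v$ are $H$-adjacent. A vertex $u\in V(G)$ is $t$-bad for $\phi$ if there exists $v\in V(H)$ with $h(v)<\eta$ such that $u$ is distinct from and $G$-adjacent to $\phi(w)$ for more than $(t-1)t^{\eta-h(v)-1}$ children $w$ of $v$ in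 $(H,r)$. -}

module Defs where

open import Level using (0ℓ)
open import Data.Nat using (ℕ; zero; suc; _+_; _*_; _∸_; _^_; _≤_; _<_)
open import Data.Fin using (Fin)
open import Data.Sum using (_⊎_; inj₁; inj₂)
open import Data.Product using (Σ; ∃; ∃-syntax; _×_; _,_)
open import Data.List using (List; []; _∷_; length; map)
open import Data.List.Relation.Unary.All using (All)
open import Data.List.Relation.Unary.Linked using (Linked)
open import Data.List.Relation.Unary.Unique.Propositional using (Unique)
open import Data.List.Membership.Propositional using (_∈_)
open import Relation.Binary.PropositionalEquality using (_≡_; _≢_)
open import Relation.Nullary using (¬_)

record Graph : Set₁ where
  field
    n     : ℕ
    Adj   : Fin n → Fin n → Set
    sym   : ∀ {x y} → Adj x y → Adj y x
    irrefl : ∀ {x} → ¬ Adj x x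

open Graph public

V : Graph → Set
V G = Fin (n G)

lastOf : ∀ {A : Set} → A → List A → A
lastOf x []       = x
lastOf x (y ∷ ys) = lastOf y ys

-- A path of G is a nonempty list of distinct vertices, consecutive ones adjacent.
-- (x ∷ xs) is a path from x to lastOf x xs, with length xs edges.
IsPath : (G : Graph) → V G → List (V G) → Set
IsPath G x xs = Linked (Adj G) (x ∷ xs) × Unique (x ∷ xs)

PathBetween : (G : Graph) → V G → V G → List (V G) → Set
PathBetween G a b xs = IsPath G a xs × lastOf a xs ≡ b

HasCycle : Graph → Set
HasCycle G = ∃[ x ] ∃[ y ] ∃[ z ] ∃[ zs ]
  (IsPath G x (y ∷ z ∷ zs) × Adj G (lastOf z zs) x)

Connected : Graph → Set
Connected G = ∀ a b → ∃[ xs ] PathBetween G a b xs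

IsTree : Graph → Set
IsTree G = Connected G × ¬ HasCycle G

-- K_{t,t} as a (not necessarily induced) subgraph: an injective map of
-- the vertex set Fin t ⊎ Fin t sending every edge (inj₁ i, inj₂ j) to an edge.
ContainsKtt : ℕ → Graph → Set
ContainsKtt t G = Σ (Fin t ⊎ Fin t → V G) λ f →
  (∀ a b → f a ≡ f b → a ≡ b) × (∀ i j → Adj G (f (inj₁ i)) (f (inj₂ j)))

RootPath : (H : Graph) → V H → List (V H) → Set
RootPath H r ps = IsPath H r ps

HasHeight : (H : Graph) → V H → V H → ℕ → Set
HasHeight H r v k = ∃[ ps ] (PathBetween H r v ps × length ps ≡ k)

Child : (H : Graph) → V H → V H → V H → Set
Child H r u v = Adj H u v × ∃[ ps ] (PathBetween H r v ps × u ∈ (r ∷ ps))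

HasTreeHeight : (H : Graph) → V H → ℕ → Set
HasTreeHeight H r η =
  (∀ v k → HasHeight H r v k → k ≤ η) × (∃[ v ] HasHeight H r v η)

NumChildren : (H : Graph) → V H → V H → ℕ → Set
NumChildren H r v c = ∃[ cs ]
  (Unique cs × All (Child H r v) cs × (∀ w → Child H r v w → w ∈ cs) × length cs ≡ c)

Tapering : ℕ → ℕ → (H : Graph) → V H → Set
Tapering t η H r = IsTree H × HasTreeHeight H r η ×
  (∀ v i → HasHeight H r v i → i < η → NumChildren H r v (t ^ (η ∸ i)))

-- (t,η)-infusion (the conditions do not actually depend on t, η)
Infusion : ℕ → ℕ → (H : Graph) → V H → (G : Graph) → (V H → V G) → Set
Infusion t η H r G φ =
  (∀ u v → Adj H u v → (φ u ≢ φ v) × Adj G (φ u) (φ v)) ×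
  (∀ u v w → Child H r u v → Child H r u w → v ≢ w → φ v ≢ φ w) ×
  (∀ ps → RootPath H r ps → Unique (map φ (r ∷ ps))) ×
  (∀ ps → RootPath H r ps → ∀ u v → u ∈ (r ∷ ps) → v ∈ (r ∷ ps) → u ≢ v →
     (Adj G (φ u) (φ v) → Adj H u v) × (Adj H u v → Adj G (φ u) (φ v)))

Bad : ℕ → ℕ → (H : Graph) → V H → (G : Graph) → (V H → V G) → V G → Set
Bad t η H r G φ u = ∃[ v ] ∃[ k ] (HasHeight H r v k × k < η ×
  ∃[ ws ] (Unique ws ×
           All (λ w → Child H r v w × u ≢ φ w × Adj G u (φ w)) ws ×
           (t ∸ 1) * t ^ (η ∸ k ∸ 1) < length ws))

-- A t-bad vertex u is witnessed by a vertex v of some height k < η and more than (t−1)·s of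
-- the t·s children of v (s = t^(η−k−1)) whose images are adjacent to u. Every such v ends a
-- root path of length k, and there are at most (t^η)^k of those, so the number N of possible
-- witnesses satisfies (t−1)·N < t^(η·η) ≤ t^(η^η). With more than (t−1)·N bad vertices, t of
-- them would share a witness v; each misses fewer than s of its children, so at least t children
-- are common to all of them, and as φ is injective on siblings this yields a K_{t,t} in G.

module Submission where

open import Defs
open import Data.Bool using (true; false)
open import Data.Empty using (⊥-elim)
open import Data.Fin using (Fin; inject≤)
import Data.Fin.Properties as Fin
open import Data.List using (List; []; _∷_; _++_; _∷ʳ_; length; map; filter; take; lookup; concatMap; initLast; _∷ʳ′_)
open import Data.List.Properties using (length-++; length-map; length-take; filter-notAll)
open import Data.List.Membership.Propositional using (_∈_)
open import Data.List.Membership.Propositional.Properties using (∈-filter⁺; ∈-filter⁻; ∈-lookup; ∈-++⁺ˡ; ∈-++⁺ʳ; ∈-map⁺)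
open import Data.List.Relation.Binary.Subset.Propositional using (_⊆_)
import Data.List.Relation.Binary.Sublist.Propositional as Sublist
import Data.List.Relation.Binary.Sublist.Propositional.Properties as Sublist
open import Data.List.Relation.Unary.All as All using (All; []; _∷_)
open import Data.List.Relation.Unary.All.Properties using (all-filter; filter⁺; ++⁻ˡ)
import Data.List.Relation.Unary.All.Properties as All
open import Data.List.Relation.Unary.AllPairs as AllPairs using ([]; _∷_)
import Data.List.Relation.Unary.AllPairs.Properties as AllPairs
open import Data.List.Relation.Unary.Any as Any using (Any; here; there)
import Data.List.Relation.Unary.Any.Properties as Any
open import Data.List.Relation.Unary.Linked using (Linked; [-]; _∷_)
open import Data.List.Relation.Unary.Unique.Propositional using (Unique)
import Data.List.Relation.Unary.Unique.Propositional.Properties as Unique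
open import Data.Nat using (ℕ; zero; suc; _+_; _*_; _∸_; _^_; _≤_; _<_; z≤n; s≤s; >-nonZero)
open import Data.Nat.Properties
open import Data.Product using (Σ; ∃-syntax; _×_; _,_; proj₁; proj₂)
open import Data.Product.Properties using (≡-dec)
open import Data.Sum using (_⊎_; inj₁; inj₂)
open import Function using (_∘_)
open import Relation.Binary.Definitions using (DecidableEquality)
open import Relation.Binary.PropositionalEquality using (_≡_; _≢_; refl; trans; cong; subst)
import Relation.Binary.PropositionalEquality as ≡
open import Relation.Nullary using (¬_; yes; no; does; ¬?; contradiction)
open import Relation.Unary using (Decidable)
open import Relation.Unary.Properties using (∁?)

geometricSum : ℕ → ℕ → ℕ
geometricSum x zero    = 0
geometricSum x (suc n) = geometricSum x n + x ^ n

*-geometricSum : ∀ m n → m * geometricSum (suc m) n + 1 ≡ suc m ^ n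
*-geometricSum m zero    = cong (_+ 1) (*-zeroʳ m)
*-geometricSum m (suc n) = begin
  m * (g + p) + 1      ≡⟨ cong (_+ 1) (*-distribˡ-+ m g p) ⟩
  m * g + m * p + 1    ≡⟨ +-assoc (m * g) (m * p) 1 ⟩
  m * g + (m * p + 1)  ≡⟨ cong (m * g +_) (+-comm (m * p) 1) ⟩
  m * g + (1 + m * p)  ≡⟨ +-assoc (m * g) 1 (m * p) ⟨
  m * g + 1 + m * p    ≡⟨ cong (_+ m * p) (*-geometricSum m n) ⟩
  p + m * p            ∎
  where
  open ≡.≡-Reasoning
  g = geometricSum (suc m) n
  p = suc m ^ n

geometricSum-< : ∀ x → 1 ≤ x → ∀ n → (x ∸ 1) * geometricSum x n < x ^ n
geometricSum-< (suc m) _ n = ≤-reflexive (trans (+-comm 1 _) (*-geometricSum m n))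

n*n≤n^n : ∀ n → n * n ≤ n ^ n
n*n≤n^n zero          = z≤n
n*n≤n^n (suc zero)    = ≤-refl
n*n≤n^n (suc (suc n)) =
  *-monoʳ-≤ (2 + n) (≤-trans (≤-reflexive (≡.sym (^-identityʳ (2 + n)))) (^-monoʳ-≤ (2 + n) {1} {1 + n} (s≤s z≤n)))

pred*geometricSum≤ : ∀ t η → 1 ≤ t → 1 ≤ η → (t ∸ 1) * geometricSum (t ^ η) η ≤ t ^ (η ^ η)
pred*geometricSum≤ (suc t) η _ 1≤η = begin
  t * geometricSum X η          ≤⟨ *-monoˡ-≤ _ (∸-monoˡ-≤ 1 t+1≤X) ⟩
  (X ∸ 1) * geometricSum X η    <⟨ geometricSum-< X (m^n>0 (suc t) η) η ⟩
  X ^ η                         ≡⟨ ^-*-assoc (suc t) η η ⟩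
  suc t ^ (η * η)               ≤⟨ ^-monoʳ-≤ (suc t) (n*n≤n^n η) ⟩
  suc t ^ (η ^ η)               ∎
  where
  open ≤-Reasoning
  X = suc t ^ η
  t+1≤X : suc t ≤ X
  t+1≤X = ≤-trans (≤-reflexive (≡.sym (^-identityʳ (suc t)))) (^-monoʳ-≤ (suc t) 1≤η)

^-pred : ∀ x n → 1 ≤ n → x ^ n ≡ x * x ^ (n ∸ 1)
^-pred x (suc n) _ = refl

∸1<⇒≤ : ∀ {t n} → 1 ≤ t → t ∸ 1 < n → t ≤ n
∸1<⇒≤ {suc t} _ t<n = t<n

few-missing : ∀ t s m w → 1 ≤ t → m + w ≤ t * s → (t ∸ 1) * s < w → m < s
few-missing (suc t) s m w _ m+w≤ts many = +-cancelʳ-< w m s (begin-strict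
  m + w       ≤⟨ m+w≤ts ⟩
  s + t * s   <⟨ +-monoʳ-< s many ⟩
  s + w       ∎)
  where open ≤-Reasoning

module _ {A : Set} {P : A → Set} (P? : Decidable P) where

  length-filter+filter-∁ : ∀ xs → length (filter P? xs) + length (filter (∁? P?) xs) ≡ length xs
  length-filter+filter-∁ []       = refl
  length-filter+filter-∁ (x ∷ xs) with ih ← length-filter+filter-∁ xs | does (P? x)
  ... | true  = cong suc ih
  ... | false = trans (+-suc _ _) (cong suc ih)

  length-filter-mono : ∀ {xs ys} → xs Sublist.⊆ ys → length (filter P? xs) ≤ length (filter P? ys)
  length-filter-mono xs⊆ys = Sublist.length-mono-≤ (Sublist.filter⁺ P? P? (λ { refl p → p }) xs⊆ys)

module _ {A : Set} (_≟_ : DecidableEquality A) where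

  open import Data.List.Membership.DecPropositional _≟_ using (_∈?_)

  unique-⊆⇒length≤ : ∀ {xs ys : List A} → Unique xs → xs ⊆ ys → length xs ≤ length ys
  unique-⊆⇒length≤ {[]}     _             _     = z≤n
  unique-⊆⇒length≤ {x ∷ xs} {ys} (x∉xs ∷ xs!) xs⊆ys = begin-strict
    length xs                   ≤⟨ unique-⊆⇒length≤ xs! xs⊆others ⟩
    length (filter others? ys)  <⟨ filter-notAll others? ys (Any.map (λ x≡y x≢y → x≢y x≡y) (xs⊆ys (here refl))) ⟩
    length ys                   ∎
    where
    open ≤-Reasoning
    others? = λ y → ¬? (x ≟ y)
    xs⊆others : xs ⊆ filter others? ys
    xs⊆others z∈xs = ∈-filter⁺ others? (xs⊆ys (there z∈xs)) (All.lookup x∉xs z∈xs)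

  missing : List A → List A → List A
  missing ws = filter (∁? (_∈? ws))

  length-missing : ∀ {ws cs} → Unique ws → ws ⊆ cs → length (missing ws cs) + length ws ≤ length cs
  length-missing {ws} {cs} ws! ws⊆cs = begin
    length (missing ws cs) + length ws                         ≤⟨ +-monoʳ-≤ _ (unique-⊆⇒length≤ ws! ws⊆present) ⟩
    length (missing ws cs) + length (filter (_∈? ws) cs)       ≡⟨ +-comm (length (missing ws cs)) _ ⟩
    length (filter (_∈? ws) cs) + length (missing ws cs)       ≡⟨ length-filter+filter-∁ (_∈? ws) cs ⟩
    length cs                                                  ∎
    where
    open ≤-Reasoning
    ws⊆present : ws ⊆ filter (_∈? ws) cs
    ws⊆present w∈ws = ∈-filter⁺ (_∈? ws) (ws⊆cs w∈ws) w∈ws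

  common : List (List A) → List A → List A
  common []         cs = cs
  common (ws ∷ wss) cs = filter (_∈? ws) (common wss cs)

  ∈-common⁻ : ∀ wss {cs c} → c ∈ common wss cs → c ∈ cs × All (c ∈_) wss
  ∈-common⁻ []         c∈cs = c∈cs , []
  ∈-common⁻ (ws ∷ wss) c∈   =
    let c∈C , c∈ws = ∈-filter⁻ (_∈? ws) c∈
        c∈cs , c∈wss = ∈-common⁻ wss c∈C
    in c∈cs , c∈ws ∷ c∈wss

  common-unique : ∀ wss {cs} → Unique cs → Unique (common wss cs)
  common-unique []         cs! = cs!
  common-unique (ws ∷ wss) cs! = Unique.filter⁺ (_∈? ws) (common-unique wss cs!)

  common-sublist : ∀ wss cs → common wss cs Sublist.⊆ cs
  common-sublist []         cs = Sublist.⊆-refl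
  common-sublist (ws ∷ wss) cs = Sublist.⊆-trans (Sublist.filter-⊆ (_∈? ws) _) (common-sublist wss cs)

  length-common : ∀ {s} wss cs → All (λ ws → length (missing ws cs) < s) wss →
                  length cs + length wss ≤ length (common wss cs) + length wss * s
  length-common     []         cs []           = ≤-refl
  length-common {s} (ws ∷ wss) cs (few ∷ fews) = begin
    length cs + suc m                     ≡⟨ +-suc _ m ⟩
    suc (length cs + m)                   ≤⟨ s≤s (length-common wss cs fews) ⟩
    suc (length C + m * s)                ≡⟨ cong (λ n → suc (n + m * s)) (≡.sym (length-filter+filter-∁ (_∈? ws) C)) ⟩
    suc (present + absent + m * s)        ≡⟨ cong suc (+-assoc present absent (m * s)) ⟩
    suc (present + (absent + m * s))      ≡⟨ +-suc present (absent + m * s) ⟨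
    present + (suc absent + m * s)        ≤⟨ +-monoʳ-≤ present (+-monoˡ-≤ (m * s) fewer) ⟩
    present + (s + m * s)                 ∎
    where
    open ≤-Reasoning
    m = length wss
    C = common wss cs
    present = length (filter (_∈? ws) C)
    absent = length (missing ws C)
    fewer : suc absent ≤ s
    fewer = ≤-trans (s≤s (length-filter-mono _ (common-sublist wss cs))) few

module _ {E B : Set} (_≟_ : DecidableEquality B) (label : E → B) where

  labelled : B → List E → List E
  labelled b = filter (λ e → label e ≟ b)

  pigeonhole : ∀ m bs (es : List E) → All (λ e → label e ∈ bs) es → m * length bs < length es →
               ∃[ b ] m < length (labelled b es)
  pigeonhole m []       []       _          ()
  pigeonhole m []       (e ∷ es) (() ∷ _)   _
  pigeonhole m (b ∷ bs) es       labels     crowded with m <? length (labelled b es)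
  ... | yes b-crowded = b , b-crowded
  ... | no  b-sparse  =
    let b′ , b′-crowded = pigeonhole m bs others others-labels others-crowded
    in b′ , ≤-trans b′-crowded (length-filter-mono _ (Sublist.filter-⊆ _ es))
    where
    open ≤-Reasoning
    others = filter (∁? (λ e → label e ≟ b)) es
    others-labels : All (λ e → label e ∈ bs) others
    others-labels = All.zipWith (λ (∈b∷bs , ≢b) → Any.tail ≢b ∈b∷bs)
                                (filter⁺ _ labels , all-filter _ es)
    others-crowded : m * length bs < length others
    others-crowded = +-cancelˡ-< m _ _ (begin-strict
      m + m * length bs                        ≡⟨ *-suc m (length bs) ⟨
      m * suc (length bs)                      <⟨ crowded ⟩
      length es                                ≡⟨ length-filter+filter-∁ _ es ⟨
      length (labelled b es) + length others   ≤⟨ +-monoˡ-≤ _ (≮⇒≥ b-sparse) ⟩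
      m + length others                        ∎)

lookup-injective : ∀ {A : Set} {xs : List A} → Unique xs → ∀ i j → lookup xs i ≡ lookup xs j → i ≡ j
lookup-injective {xs = _ ∷ _} _            Fin.zero    Fin.zero    _  = refl
lookup-injective {xs = _ ∷ _} (x∉xs ∷ _)   Fin.zero    (Fin.suc j) eq = ⊥-elim (All.lookup x∉xs (∈-lookup j) eq)
lookup-injective {xs = _ ∷ _} (x∉xs ∷ _)   (Fin.suc i) Fin.zero    eq = ⊥-elim (All.lookup x∉xs (∈-lookup i) (≡.sym eq))
lookup-injective {xs = _ ∷ _} (_ ∷ xs!)    (Fin.suc i) (Fin.suc j) eq = cong Fin.suc (lookup-injective xs! i j eq)

unique-map⁺ : ∀ {A B : Set} {P : A → Set} {f : A → B} {xs} →
              (∀ {x y} → P x → P y → x ≢ y → f x ≢ f y) → All P xs → Unique xs → Unique (map f xs)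
unique-map⁺ f-inj []         []            = []
unique-map⁺ f-inj (px ∷ pxs) (x∉xs ∷ xs!) =
  All.map⁺ (All.zipWith (λ (py , x≢y) → f-inj px py x≢y) (pxs , x∉xs)) ∷ unique-map⁺ f-inj pxs xs!

biclique⇒Ktt : ∀ {t} (G : Graph) {us ws : List (V G)} → Unique us → Unique ws →
               t ≤ length us → t ≤ length ws → All (λ u → All (Adj G u) ws) us → ContainsKtt t G
biclique⇒Ktt {t} G {us} {ws} us! ws! t≤us t≤ws adjacent = f , f-injective , f-adjacent
  where
  f : Fin t ⊎ Fin t → V G
  f (inj₁ i) = lookup us (inject≤ i t≤us)
  f (inj₂ j) = lookup ws (inject≤ j t≤ws)

  f-adjacent : ∀ i j → Adj G (f (inj₁ i)) (f (inj₂ j))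
  f-adjacent i j = All.lookup (All.lookup adjacent (∈-lookup _)) (∈-lookup _)

  f-injective : ∀ a b → f a ≡ f b → a ≡ b
  f-injective (inj₁ i) (inj₁ j) eq = cong inj₁ (Fin.inject≤-injective _ _ i j (lookup-injective us! _ _ eq))
  f-injective (inj₂ i) (inj₂ j) eq = cong inj₂ (Fin.inject≤-injective _ _ i j (lookup-injective ws! _ _ eq))
  f-injective (inj₁ i) (inj₂ j) eq = ⊥-elim (irrefl G (subst (λ x → Adj G x (f (inj₂ j))) eq (f-adjacent i j)))
  f-injective (inj₂ j) (inj₁ i) eq = ⊥-elim (irrefl G (subst (Adj G (f (inj₁ i))) eq (f-adjacent i j)))

module _ {A : Set} (_≟_ : DecidableEquality A) (G : Graph) (φ : A → V G) where

  -- Each of the t vertices misses at most s − 1 of the t·s candidates, so at most t·s − t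
  -- candidates are missed by some of them and at least t are common neighbours of all.
  commonNeighbours⇒Ktt :
    ∀ {I : Set} t s {cs : List A} → 1 ≤ t → Unique cs → length cs ≡ t * s →
    (∀ {x y} → x ∈ cs → y ∈ cs → x ≢ y → φ x ≢ φ y) →
    (vertex : I → V G) (nbrs : I → List A) (ys : List I) → Unique (map vertex ys) → length ys ≡ t →
    All (λ y → Unique (nbrs y) × nbrs y ⊆ cs × (t ∸ 1) * s < length (nbrs y) ×
               All (Adj G (vertex y) ∘ φ) (nbrs y)) ys →
    ContainsKtt t G
  commonNeighbours⇒Ktt t s {cs} 1≤t cs! |cs| φ-injective vertex nbrs ys ys! |ys| nbrs-props =
    biclique⇒Ktt G ys! (unique-map⁺ φ-injective (All.tabulate (proj₁ ∘ ∈-common⁻ _≟_ wss)) C!)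
                 (≤-reflexive (≡.sym (trans (length-map vertex ys) |ys|)))
                 (≤-trans t≤C (≤-reflexive (≡.sym (length-map φ C))))
                 (All.map⁺ (All.tabulate adjacent))
    where
    open ≤-Reasoning
    wss = map nbrs ys
    C = common _≟_ wss cs
    C! = common-unique _≟_ wss cs!
    |wss| : length wss ≡ t
    |wss| = trans (length-map nbrs ys) |ys|

    few : All (λ ws → length (missing _≟_ ws cs) < s) wss
    few = All.map⁺ (All.map (λ (ws! , ws⊆cs , many , _) →
            few-missing t s _ _ 1≤t (≤-trans (length-missing _≟_ ws! ws⊆cs) (≤-reflexive |cs|)) many) nbrs-props)

    t≤C : t ≤ length C
    t≤C = +-cancelˡ-≤ (t * s) t (length C) (begin
      t * s + t                  ≡⟨ ≡.cong₂ _+_ (≡.sym |cs|) (≡.sym |wss|) ⟩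
      length cs + length wss     ≤⟨ length-common _≟_ wss cs few ⟩
      length C + length wss * s  ≡⟨ cong (λ m → length C + m * s) |wss| ⟩
      length C + t * s           ≡⟨ +-comm (length C) (t * s) ⟩
      t * s + length C           ∎)

    adjacent : ∀ {y} → y ∈ ys → All (Adj G (vertex y)) (map φ C)
    adjacent y∈ys = All.map⁺ (All.tabulate λ c∈C →
      All.lookup (proj₂ (proj₂ (proj₂ (All.lookup nbrs-props y∈ys))))
                 (All.lookup (All.map⁻ (proj₂ (∈-common⁻ _≟_ wss c∈C))) y∈ys))

module _ {A : Set} where

  lastOf-∷ʳ : ∀ (x : A) ys y → lastOf x (ys ∷ʳ y) ≡ y
  lastOf-∷ʳ x []       y = refl
  lastOf-∷ʳ x (z ∷ ys) y = lastOf-∷ʳ z ys y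

  lastOf-∈ : ∀ (x : A) ys → lastOf x ys ∈ x ∷ ys
  lastOf-∈ x []       = here refl
  lastOf-∈ x (y ∷ ys) = there (lastOf-∈ y ys)

  length-∷ʳ : ∀ (xs : List A) x → length (xs ∷ʳ x) ≡ suc (length xs)
  length-∷ʳ xs x = trans (length-++ xs) (+-comm (length xs) 1)

  unique-++⁻ˡ : ∀ (xs : List A) {ys} → Unique (xs ++ ys) → Unique xs
  unique-++⁻ˡ []       _             = []
  unique-++⁻ˡ (x ∷ xs) (x∉ ∷ xs++ys!) = ++⁻ˡ xs x∉ ∷ unique-++⁻ˡ xs xs++ys!

  module _ {R : A → A → Set} where

    linked-∷ʳ⁺ : ∀ x ys {y} → Linked R (x ∷ ys) → R (lastOf x ys) y → Linked R (x ∷ (ys ∷ʳ y))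
    linked-∷ʳ⁺ x []       _          Rxy = Rxy ∷ [-]
    linked-∷ʳ⁺ x (z ∷ ys) (Rxz ∷ Rzs) Rzy = Rxz ∷ linked-∷ʳ⁺ z ys Rzs Rzy

    linked-∷ʳ⁻ : ∀ x ys {y} → Linked R (x ∷ (ys ∷ʳ y)) → Linked R (x ∷ ys) × R (lastOf x ys) y
    linked-∷ʳ⁻ x []       (Rxy ∷ _)   = [-] , Rxy
    linked-∷ʳ⁻ x (z ∷ ys) (Rxz ∷ Rzs) = let Rzys , Ry = linked-∷ʳ⁻ z ys Rzs in Rxz ∷ Rzys , Ry

length-concatMap : ∀ {A B : Set} (f : A → List B) {d} → (∀ x → length (f x) ≤ d) →
                   ∀ xs → length (concatMap f xs) ≤ length xs * d
length-concatMap f f≤d []       = z≤n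
length-concatMap f f≤d (x ∷ xs) = ≤-trans (≤-reflexive (length-++ (f x))) (+-mono-≤ (f≤d x) (length-concatMap f f≤d xs))

module RootPaths (H : Graph) (r : V H) (η d : ℕ)
  (fewChildren : ∀ v k → HasHeight H r v k → k < η → ∃[ c ] (c ≤ d × NumChildren H r v c)) where

  open import Data.List.Relation.Unary.Unique.DecPropositional (Fin._≟_ {n H}) using (unique?)

  RootPathOfLength : ℕ → Set
  RootPathOfLength k = Σ (List (V H)) λ ps → RootPath H r ps × length ps ≡ k

  height : ∀ {k} (p : RootPathOfLength k) → HasHeight H r (lastOf r (proj₁ p)) k
  height (ps , rp , |ps|) = ps , (rp , refl) , |ps|

  -- H is not assumed acyclic here, so a child of the last vertex may already lie on the path;
  -- such extensions are not paths and are dropped.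
  extendBy : ∀ {k} (p : RootPathOfLength k) (cs : List (V H)) →
             All (Adj H (lastOf r (proj₁ p))) cs → List (RootPathOfLength (suc k))
  extendBy p              []       []           = []
  extendBy p@(q , (linked , _) , |q|) (c ∷ cs) (adj ∷ adjs) with unique? (r ∷ (q ∷ʳ c))
  ... | yes unique = (q ∷ʳ c , (linked-∷ʳ⁺ r q linked adj , unique) , trans (length-∷ʳ q c) (cong suc |q|))
                     ∷ extendBy p cs adjs
  ... | no  _      = extendBy p cs adjs

  length-extendBy : ∀ {k} (p : RootPathOfLength k) cs adjs → length (extendBy p cs adjs) ≤ length cs
  length-extendBy p              []       []           = z≤n
  length-extendBy p@(q , _ , _) (c ∷ cs) (adj ∷ adjs) with unique? (r ∷ (q ∷ʳ c))
  ... | yes _ = s≤s (length-extendBy p cs adjs)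
  ... | no  _ = m≤n⇒m≤1+n (length-extendBy p cs adjs)

  extendBy-complete : ∀ {k} (p : RootPathOfLength k) cs adjs {c} → c ∈ cs → Unique (r ∷ (proj₁ p ∷ʳ c)) →
                      Any ((proj₁ p ∷ʳ c ≡_) ∘ proj₁) (extendBy p cs adjs)
  extendBy-complete p@(q , _ , _) (c ∷ cs) (adj ∷ adjs) c∈ unique with unique? (r ∷ (q ∷ʳ c))
  extendBy-complete p (c ∷ cs) (adj ∷ adjs) (here refl) unique | yes _  = here refl
  extendBy-complete p (c ∷ cs) (adj ∷ adjs) (there c∈) unique  | yes _  = there (extendBy-complete p cs adjs c∈ unique)
  extendBy-complete p (c ∷ cs) (adj ∷ adjs) (here refl) unique | no ¬u = contradiction unique ¬u
  extendBy-complete p (c ∷ cs) (adj ∷ adjs) (there c∈) unique  | no _  = extendBy-complete p cs adjs c∈ unique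

  extend : ∀ {k} → k < η → RootPathOfLength k → List (RootPathOfLength (suc k))
  extend k<η p with fewChildren _ _ (height p) k<η
  ... | _ , _ , cs , _ , children , _ , _ = extendBy p cs (All.map proj₁ children)

  length-extend : ∀ {k} (k<η : k < η) p → length (extend k<η p) ≤ d
  length-extend k<η p with fewChildren _ _ (height p) k<η
  ... | _ , c≤d , cs , _ , children , _ , |cs| =
    ≤-trans (length-extendBy p cs (All.map proj₁ children)) (≤-trans (≤-reflexive |cs|) c≤d)

  extend-complete : ∀ {k} (k<η : k < η) p {c} → Child H r (lastOf r (proj₁ p)) c → Unique (r ∷ (proj₁ p ∷ʳ c)) →
                    Any ((proj₁ p ∷ʳ c ≡_) ∘ proj₁) (extend k<η p)
  extend-complete k<η p child unique with fewChildren _ _ (height p) k<η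
  ... | _ , _ , cs , _ , children , complete , _ =
    extendBy-complete p cs (All.map proj₁ children) (complete _ child) unique

  rootPaths : ∀ k → k ≤ η → List (RootPathOfLength k)
  rootPaths zero    _   = ([] , ([-] , [] ∷ []) , refl) ∷ []
  rootPaths (suc k) k<η = concatMap (extend k<η) (rootPaths k (<⇒≤ k<η))

  length-rootPaths : ∀ k k≤η → length (rootPaths k k≤η) ≤ d ^ k
  length-rootPaths zero    _   = ≤-refl
  length-rootPaths (suc k) k<η = begin
    length (concatMap (extend k<η) ps)  ≤⟨ length-concatMap (extend k<η) (length-extend k<η) ps ⟩
    length ps * d                       ≤⟨ *-monoˡ-≤ d (length-rootPaths k (<⇒≤ k<η)) ⟩
    d ^ k * d                           ≡⟨ *-comm (d ^ k) d ⟩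
    d ^ suc k                           ∎
    where
    open ≤-Reasoning
    ps = rootPaths k (<⇒≤ k<η)

  rootPaths-complete : ∀ k k≤η {ps} → RootPath H r ps → length ps ≡ k → Any ((ps ≡_) ∘ proj₁) (rootPaths k k≤η)
  rootPaths-complete zero    _   {[]} _ _ = here refl
  rootPaths-complete (suc k) k<η {ps} rp |ps| with initLast ps
  ... | []        = contradiction |ps| λ ()
  ... | q ∷ʳ′ c   = Any.concat⁺ (Any.map⁺ (Any.map extension (rootPaths-complete k (<⇒≤ k<η) q-root |q|)))
    where
    q-root : RootPath H r q
    q-root = proj₁ (linked-∷ʳ⁻ r q (proj₁ rp)) , unique-++⁻ˡ (r ∷ q) (proj₂ rp)
    |q| : length q ≡ k
    |q| = suc-injective (trans (≡.sym (length-∷ʳ q c)) |ps|)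
    child : Child H r (lastOf r q) c
    child = proj₂ (linked-∷ʳ⁻ r q (proj₁ rp)) , q ∷ʳ c , (rp , lastOf-∷ʳ r q c) , ∈-++⁺ˡ (lastOf-∈ r q)
    extension : ∀ {p} → q ≡ proj₁ p → Any ((q ∷ʳ c ≡_) ∘ proj₁) (extend k<η p)
    extension {p} refl = extend-complete k<η p child (proj₂ rp)

  shortRootPaths : ∀ n → n ≤ η → List (List (V H))
  shortRootPaths zero    _   = []
  shortRootPaths (suc n) n<η = shortRootPaths n (<⇒≤ n<η) ++ map proj₁ (rootPaths n (<⇒≤ n<η))

  length-shortRootPaths : ∀ n n≤η → length (shortRootPaths n n≤η) ≤ geometricSum d n
  length-shortRootPaths zero    _   = z≤n
  length-shortRootPaths (suc n) n<η = ≤-trans (≤-reflexive (length-++ (shortRootPaths n n≤η)))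
    (+-mono-≤ (length-shortRootPaths n n≤η)
              (≤-trans (≤-reflexive (length-map proj₁ (rootPaths n n≤η))) (length-rootPaths n n≤η)))
    where n≤η = <⇒≤ n<η

  shortRootPaths-complete : ∀ n n≤η {ps} → RootPath H r ps → length ps < n → ps ∈ shortRootPaths n n≤η
  shortRootPaths-complete (suc n) n<η rp |ps|<1+n with m<1+n⇒m<n∨m≡n |ps|<1+n
  ... | inj₁ |ps|<n = ∈-++⁺ˡ (shortRootPaths-complete n (<⇒≤ n<η) rp |ps|<n)
  ... | inj₂ |ps|≡n = ∈-++⁺ʳ _ (Any.map⁺ (rootPaths-complete n (<⇒≤ n<η) rp |ps|≡n))

map-proj₁-toList : ∀ {A : Set} {P : A → Set} {xs} (pxs : All P xs) → map proj₁ (All.toList pxs) ≡ xs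
map-proj₁-toList []         = refl
map-proj₁-toList (px ∷ pxs) = cong (_ ∷_) (map-proj₁-toList pxs)

module BadVertices (t η : ℕ) (1≤t : 1 ≤ t) (H : Graph) (r : V H)
  (numChildren : ∀ v k → HasHeight H r v k → k < η → NumChildren H r v (t ^ (η ∸ k)))
  (G : Graph) (φ : V H → V G)
  (siblings : ∀ u v w → Child H r u v → Child H r u w → v ≢ w → φ v ≢ φ w) where

  BadVertex : Set
  BadVertex = Σ (V G) (Bad t η H r G φ)

  centre : BadVertex → V H × ℕ
  centre (_ , v , k , _) = v , k

  neighbours : BadVertex → List (V H)
  neighbours (_ , _ , _ , _ , _ , ws , _) = ws

  sharedCentre⇒Ktt : ∀ {v k} → k < η → NumChildren H r v (t ^ (η ∸ k)) →
                     (ys : List BadVertex) → All ((_≡ (v , k)) ∘ centre) ys →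
                     Unique (map proj₁ ys) → length ys ≡ t → ContainsKtt t G
  sharedCentre⇒Ktt {v} {k} k<η (cs , cs! , children , complete , |cs|) ys at-centre ys! |ys| =
    commonNeighbours⇒Ktt Fin._≟_ G φ t s 1≤t cs! (trans |cs| (^-pred t (η ∸ k) (m<n⇒0<n∸m k<η)))
      (λ c∈cs c′∈cs → siblings v _ _ (All.lookup children c∈cs) (All.lookup children c′∈cs))
      proj₁ neighbours ys ys! |ys| (All.map (λ {y} → neighbourhood {y}) at-centre)
    where
    s = t ^ (η ∸ k ∸ 1)
    neighbourhood : ∀ {y} → centre y ≡ (v , k) →
                    Unique (neighbours y) × neighbours y ⊆ cs × (t ∸ 1) * s < length (neighbours y) ×
                    All (Adj G (proj₁ y) ∘ φ) (neighbours y)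
    neighbourhood {_ , _ , _ , _ , _ , _ , ws! , adjacent , many} refl =
      ws! , (λ w∈ws → complete _ (proj₁ (All.lookup adjacent w∈ws))) , many , All.map (proj₂ ∘ proj₂) adjacent

  crowdedCentre⇒Ktt : ∀ {c} (ys : List BadVertex) → All ((_≡ c) ∘ centre) ys →
                      Unique (map proj₁ ys) → length ys ≡ t → ContainsKtt t G
  crowdedCentre⇒Ktt [] _ _ |ys| = contradiction (≤-trans 1≤t (≤-reflexive (≡.sym |ys|))) λ ()
  crowdedCentre⇒Ktt ys@((_ , v , k , hk , k<η , _) ∷ _) at-centre@(refl ∷ _) =
    sharedCentre⇒Ktt k<η (numChildren v k hk k<η) ys at-centre

  open RootPaths H r η (t ^ η)
    (λ v k hk k<η → t ^ (η ∸ k) , ^-monoʳ-≤ t {{>-nonZero 1≤t}} (m∸n≤m η k) , numChildren v k hk k<η)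

  centres : List (V H × ℕ)
  centres = map (λ ps → lastOf r ps , length ps) (shortRootPaths η ≤-refl)

  centre∈centres : ∀ y → centre y ∈ centres
  centre∈centres (_ , _ , _ , (ps , (rp , refl) , refl) , k<η , _) = ∈-map⁺ _ (shortRootPaths-complete η ≤-refl rp k<η)

  length-centres : length centres ≤ geometricSum (t ^ η) η
  length-centres = ≤-trans (≤-reflexive (length-map _ (shortRootPaths η ≤-refl))) (length-shortRootPaths η ≤-refl)

  _≟ᶜ_ : DecidableEquality (V H × ℕ)
  _≟ᶜ_ = ≡-dec Fin._≟_ _≟_

  many⇒Ktt : (ys : List BadVertex) → Unique (map proj₁ ys) → (t ∸ 1) * length centres < length ys → ContainsKtt t G
  many⇒Ktt ys ys! crowded =
    let c , c-crowded = pigeonhole _≟ᶜ_ centre (t ∸ 1) centres ys (All.tabulate λ {y} _ → centre∈centres y) crowded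
    in crowdedCentre⇒Ktt (take t (labelled _≟ᶜ_ centre c ys))
         (All.take⁺ t (all-filter _ ys))
         (AllPairs.map⁺ (AllPairs.take⁺ t (AllPairs.filter⁺ _ (AllPairs.map⁻ ys!))))
         (trans (length-take t _) (m≤n⇒m⊓n≡m (∸1<⇒≤ 1≤t c-crowded)))

  length-bad : ¬ ContainsKtt t G → ∀ {bad} → Unique bad → All (Bad t η H r G φ) bad →
               length bad ≤ (t ∸ 1) * geometricSum (t ^ η) η
  length-bad noKtt {bad} bad! allBad = begin
    length bad                        ≡⟨ cong length (map-proj₁-toList allBad) ⟨
    length (map proj₁ ys)             ≡⟨ length-map proj₁ ys ⟩
    length ys                         ≤⟨ ≮⇒≥ (noKtt ∘ many⇒Ktt ys ys!′) ⟩
    (t ∸ 1) * length centres          ≤⟨ *-monoʳ-≤ (t ∸ 1) length-centres ⟩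
    (t ∸ 1) * geometricSum (t ^ η) η  ∎
    where
    open ≤-Reasoning
    ys = All.toList allBad
    ys!′ : Unique (map proj₁ ys)
    ys!′ = subst Unique (≡.sym (map-proj₁-toList allBad)) bad!

mainTheorem10 : (t η : ℕ) → 1 ≤ t → 1 ≤ η →
    (H : Graph) (r : V H) → Tapering t η H r →
    (G : Graph) → ¬ ContainsKtt t G →
    (φ : V H → V G) → Infusion t η H r G φ →
    (bad : List (V G)) → Unique bad → All (Bad t η H r G φ) bad →
    length bad ≤ t ^ (η ^ η)
mainTheorem10 t η 1≤t 1≤η H r (_ , _ , numChildren) G noKtt φ (_ , siblings , _) bad bad! allBad =
  ≤-trans (length-bad noKtt bad! allBad) (pred*geometricSum≤ t η 1≤t 1≤η)
  where open BadVertices t η 1≤t H r numChildren G φ siblings
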